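{- Let $n\ge4$ be an integer with $n\equiv r\pmod 6$, $r\in\{0,1,2,3\}$, let $\mathrm{TH}_m=\binom{m+2}{3}$, and let $\mathcal{TH}_n=\langle \mathrm{TH}_n,\mathrm{TH}_{n+1},\mathrm{TH}_{n+2},\mathrm{TH}_{n+3}\rangle$ with minimal system of generators arranged as $(n_1,n_2,n_3,n_4)=(\mathrm{TH}_n,\mathrm{TH}_{n+1},\mathrm{TH}_{n+2},\mathrm{TH}_{n+3})$. Then, with $k$ a non-negative integer: (1) $c^*_2=\frac{n}{3}$, $c^*_3=n+1$, $c^*_4=\frac{n+2}{2}$ if $n=6k$; (2) $c^*_2=n$, $c^*_3=\frac{n+1}{2}$, $c^*_4=\frac{n+2}{3}$ if $n=6k+1$; (3) $c^*_2=n$, $c^*_3=\frac{n+1}{3}$, $c^*_4=\frac{n+2}{2}$ if $n=6k+2$; (4) $c^*_2=\frac{n}{3}$, $c^*_3=\frac{n+1}{2}$, $c^*_4=n+2$ if $n=6k+3$.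
   Context: $\langle a_1,\ldots,a_k\rangle$ denotes the set of non-negative integer linear combinations of $a_1,\ldots,a_k$. For a numerical semigroup with minimal system of generators arranged as $(n_1,\ldots,n_e)$, and $i\in\{2,\ldots,e\}$, $c^*_i=\min\{k\in\mathbb N,\ k\ge1 \mid k n_i\in\langle n_1,\ldots,n_{i-1}\rangle\}$. For $n\ge4$, $\{\mathrm{TH}_n,\ldots,\mathrm{TH}_{n+3}\}$ is the minimal system of generators of $\mathcal{TH}_n$. -}

module Defs where

open import Data.Nat using (ℕ; zero; suc; _+_; _*_; _≤_; _<_)
open import Data.Nat.Combinatorics using (_C_)
open import Data.List using (List; []; _∷_)
open import Data.Product using (∃-syntax; Σ-syntax; _×_)
open import Relation.Binary.PropositionalEquality using (_≡_)
open import Relation.Nullary using (¬_)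

TH : ℕ → ℕ
TH m = (m + 2) C 3

data _∈⟨_⟩ : ℕ → List ℕ → Set where
  nil  : 0 ∈⟨ [] ⟩
  cons : ∀ {x g gs} (a : ℕ) {y : ℕ} → y ∈⟨ gs ⟩ → x ≡ a * g + y → x ∈⟨ g ∷ gs ⟩

IsMinMult : List ℕ → ℕ → ℕ → Set
IsMinMult gs m c =
  1 ≤ c × (c * m) ∈⟨ gs ⟩ × (∀ k → 1 ≤ k → k < c → ¬ ((k * m) ∈⟨ gs ⟩))

c*₂ c*₃ c*₄ : ℕ → ℕ → Set
c*₂ n c = IsMinMult (TH n ∷ []) (TH (n + 1)) c
c*₃ n c = IsMinMult (TH n ∷ TH (n + 1) ∷ []) (TH (n + 2)) c
c*₄ n c = IsMinMult (TH n ∷ TH (n + 1) ∷ TH (n + 2) ∷ []) (TH (n + 3)) c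

{-# OPTIONS --safe #-}
module Submission where

-- Put P x = x (x + 1) (x + 2) = 6 TH x.  Scaling all generators and the
-- target by 6 does not change a least multiple, so each c*ᵢ can be computed
-- with the values P (n + j), which for n = 6k + r are products of linear
-- polynomials in k.  In each of the twelve cases the claimed value c comes
-- with a factor q such that c q divides all earlier generators while the new
-- one is e q with c and e coprime (certified by a Bézout identity between
-- polynomials in k); so c divides every k' with k' nᵢ in the semigroup.
-- Conversely an explicit identity writes c nᵢ as a combination of the
-- earlier generators.

open import Defs
open import Data.List using ([]; _∷_; [_]; map)
open import Data.List.Properties using (map-∘; map-cong)
open import Data.List.Relation.Unary.All using (All; []; _∷_)
open import Data.Nat using (ℕ; zero; suc; _+_; _*_; _≤_; _<_; _/_; NonZero; >-nonZero; s≤s; z≤n)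
open import Data.Nat.Combinatorics using (_C_; nC1≡n; nCk+nC[k+1]≡[n+1]C[k+1])
open import Data.Nat.Coprimality using (Coprime; Bézout-coprime; coprime-divisor)
open import Data.Nat.DivMod using (m*n/n≡m)
open import Data.Nat.Divisibility using (_∣_; divides; _∣0; ∣m∣n⇒∣m+n; ∣n⇒∣m*n; *-cancelʳ-∣; ∣⇒≤)
open import Data.Nat.GCD using (module Bézout)
open import Data.Nat.Properties
  using (+-comm; *-assoc; *-zeroʳ; *-identityʳ; *-distribˡ-+; *-cancelˡ-≡; *-commutativeSemigroup;
         ≤-trans; <⇒≱; m≤n+m; m≤n*m)
open import Algebra.Properties.CommutativeSemigroup *-commutativeSemigroup using (x∙yz≈y∙xz; x∙yz≈yx∙z)
open import Data.Nat.Tactic.RingSolver using (solve)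
open import Data.Product using (∃-syntax; _×_; _,_)
open import Relation.Binary.PropositionalEquality
  using (_≡_; refl; sym; trans; cong; cong₂; subst; subst₂; module ≡-Reasoning)
open import Relation.Nullary using (¬_)

open Bézout.Identity using (+-; -+)

2*[1+m]C2≡[1+m]*m : ∀ m → 2 * (suc m C 2) ≡ suc m * m
2*[1+m]C2≡[1+m]*m zero    = refl
2*[1+m]C2≡[1+m]*m (suc m) = begin
  2 * (suc (suc m) C 2)          ≡⟨ cong (2 *_) (nCk+nC[k+1]≡[n+1]C[k+1] (suc m) 1) ⟨
  2 * (suc m C 1 + suc m C 2)    ≡⟨ *-distribˡ-+ 2 (suc m C 1) (suc m C 2) ⟩
  2 * (suc m C 1) + 2 * (suc m C 2)
    ≡⟨ cong₂ (λ a b → 2 * a + b) (nC1≡n (suc m)) (2*[1+m]C2≡[1+m]*m m) ⟩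
  2 * suc m + suc m * m          ≡⟨ solve [ m ] ⟩
  suc (suc m) * suc m            ∎
  where open ≡-Reasoning

6*[2+m]C3≡[2+m]*[1+m]*m : ∀ m → 6 * (suc (suc m) C 3) ≡ suc (suc m) * suc m * m
6*[2+m]C3≡[2+m]*[1+m]*m zero    = refl
6*[2+m]C3≡[2+m]*[1+m]*m (suc m) = begin
  6 * (suc (suc (suc m)) C 3)                 ≡⟨ cong (6 *_) (nCk+nC[k+1]≡[n+1]C[k+1] (suc (suc m)) 2) ⟨
  6 * (suc (suc m) C 2 + suc (suc m) C 3)     ≡⟨ *-distribˡ-+ 6 (suc (suc m) C 2) (suc (suc m) C 3) ⟩
  6 * (suc (suc m) C 2) + 6 * (suc (suc m) C 3) ≡⟨ cong (_+ 6 * (suc (suc m) C 3)) (*-assoc 3 2 (suc (suc m) C 2)) ⟩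
  3 * (2 * (suc (suc m) C 2)) + 6 * (suc (suc m) C 3)
    ≡⟨ cong₂ (λ a b → 3 * a + b) (2*[1+m]C2≡[1+m]*m (suc m)) (6*[2+m]C3≡[2+m]*[1+m]*m m) ⟩
  3 * (suc (suc m) * suc m) + suc (suc m) * suc m * m ≡⟨ solve [ m ] ⟩
  suc (suc (suc m)) * suc (suc m) * suc m     ∎
  where open ≡-Reasoning

6*TH[m]≡m*[m+1]*[m+2] : ∀ m → 6 * TH m ≡ m * (m + 1) * (m + 2)
6*TH[m]≡m*[m+1]*[m+2] m rewrite +-comm m 2 = trans (6*[2+m]C3≡[2+m]*[1+m]*m m) (solve [ m ])

∈⟨⟩⇒∣ : ∀ {d x gs} → All (d ∣_) gs → x ∈⟨ gs ⟩ → d ∣ x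
∈⟨⟩⇒∣ []         nil               = _ ∣0
∈⟨⟩⇒∣ (d∣g ∷ ds) (cons a x∈ refl) = ∣m∣n⇒∣m+n (∣n⇒∣m*n a d∣g) (∈⟨⟩⇒∣ ds x∈)

s*[a*g+y]≡a*[s*g]+s*y : ∀ s a g y → s * (a * g + y) ≡ a * (s * g) + s * y
s*[a*g+y]≡a*[s*g]+s*y s a g y = trans (*-distribˡ-+ s (a * g) y) (cong (_+ s * y) (x∙yz≈y∙xz s a g))

∈⟨⟩-* : ∀ s {x gs} → x ∈⟨ gs ⟩ → (s * x) ∈⟨ map (s *_) gs ⟩
∈⟨⟩-* s nil rewrite *-zeroʳ s = nil
∈⟨⟩-* s (cons {g = g} a {y} y∈ refl) =
  cons a (∈⟨⟩-* s y∈) (s*[a*g+y]≡a*[s*g]+s*y s a g y)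

∈⟨map-*⟩⇒ : ∀ s gs {y} → y ∈⟨ map (s *_) gs ⟩ → ∃[ x ] y ≡ s * x × x ∈⟨ gs ⟩
∈⟨map-*⟩⇒ s []       nil = 0 , sym (*-zeroʳ s) , nil
∈⟨map-*⟩⇒ s (g ∷ gs) (cons a y∈ refl) with ∈⟨map-*⟩⇒ s gs y∈
... | x , refl , x∈ =
  a * g + x , sym (s*[a*g+y]≡a*[s*g]+s*y s a g x) , cons a x∈ refl

∈⟨⟩-*-cancel : ∀ s {x} gs .{{_ : NonZero s}} → (s * x) ∈⟨ map (s *_) gs ⟩ → x ∈⟨ gs ⟩
∈⟨⟩-*-cancel s {x} gs sx∈ with ∈⟨map-*⟩⇒ s gs sx∈
... | x′ , sx≡sx′ , x′∈ = subst (_∈⟨ gs ⟩) (sym (*-cancelˡ-≡ x x′ s sx≡sx′)) x′∈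

IsMinMult-*-cancel : ∀ s {gs m c} .{{_ : NonZero s}} →
  IsMinMult (map (s *_) gs) (s * m) c → IsMinMult gs m c
IsMinMult-*-cancel s {gs} {m} {c} (1≤c , c*sm∈ , minimal) =
  1≤c , ∈⟨⟩-*-cancel s gs (subst (_∈⟨ map (s *_) gs ⟩) (x∙yz≈y∙xz c s m) c*sm∈) ,
  λ k 1≤k k<c k*m∈ → minimal k 1≤k k<c
    (subst (_∈⟨ map (s *_) gs ⟩) (x∙yz≈y∙xz s k m) (∈⟨⟩-* s k*m∈))

coprime⇒IsMinMult : ∀ {gs m c} q e .{{_ : NonZero q}} → 1 ≤ c → All (c * q ∣_) gs →
  m ≡ e * q → Coprime c e → (c * m) ∈⟨ gs ⟩ → IsMinMult gs m c
coprime⇒IsMinMult {gs} {c = c} q e 1≤c cq∣gs refl c⊥e c*m∈ = 1≤c , c*m∈ , c-least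
  where
  c-least : ∀ k → 1 ≤ k → k < c → ¬ ((k * (e * q)) ∈⟨ gs ⟩)
  c-least k 1≤k k<c k*m∈ = <⇒≱ k<c (∣⇒≤ {{>-nonZero 1≤k}} c∣k)
    where
    c∣k : c ∣ k
    c∣k = coprime-divisor c⊥e
      (*-cancelʳ-∣ q (subst (c * q ∣_) (x∙yz≈yx∙z k e q) (∈⟨⟩⇒∣ cq∣gs k*m∈)))

-- x (x + 1) (x + 2) is spelled out rather than named so that the goals of the
-- case lemmas below reduce to polynomial identities in k for the ring solver.
Bézout⇒IsMinMult-TH : ∀ ns m {c} q e .{{_ : NonZero q}} → 1 ≤ c →
  All (c * q ∣_) (map (λ x → x * (x + 1) * (x + 2)) ns) →
  m * (m + 1) * (m + 2) ≡ e * q → Bézout.Identity 1 c e →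
  (c * (m * (m + 1) * (m + 2))) ∈⟨ map (λ x → x * (x + 1) * (x + 2)) ns ⟩ →
  IsMinMult (map TH ns) (TH m) c
Bézout⇒IsMinMult-TH ns m {c} q e 1≤c cq∣gs Pm≡eq bézout c*Pm∈ =
  IsMinMult-*-cancel 6 (subst₂ (λ gs t → IsMinMult gs t c) (sym 6*TH[ns]≡P[ns]) (sym (6*TH[m]≡m*[m+1]*[m+2] m))
    (coprime⇒IsMinMult q e 1≤c cq∣gs Pm≡eq c⊥e c*Pm∈))
  where
  6*TH[ns]≡P[ns] : map (6 *_) (map TH ns) ≡ map (λ x → x * (x + 1) * (x + 2)) ns
  6*TH[ns]≡P[ns] = trans (sym (map-∘ ns)) (map-cong 6*TH[m]≡m*[m+1]*[m+2] ns)

  c⊥e : Coprime c e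
  c⊥e = Bézout-coprime {d = 1} (subst₂ (Bézout.Identity 1) (sym (*-identityʳ c)) (sym (*-identityʳ e)) bézout)

-- The factors of q are written 1 + a * k so that NonZero q is found by instance search.
c*-6k : ∀ k → 1 ≤ k →
  c*₂ (6 * k) (2 * k) × c*₃ (6 * k) (6 * k + 1) × c*₄ (6 * k) (3 * k + 1)
c*-6k k 1≤k =
    Bézout⇒IsMinMult-TH (6 * k ∷ []) (6 * k + 1) (6 * ((1 + 3 * k) * (1 + 6 * k))) (2 * k + 1)
      (≤-trans 1≤k (m≤n*m k 2))
      (divides 1 (solve [ k ]) ∷ [])
      (solve [ k ]) (-+ 1 1 (solve [ k ]))
      (cons (2 * k + 1) nil (solve [ k ]))
  , Bézout⇒IsMinMult-TH (6 * k ∷ 6 * k + 1 ∷ []) (6 * k + 2) (6 * (1 + 3 * k)) (2 * ((2 * k + 1) * (3 * k + 2)))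
      (m≤n+m 1 (6 * k))
      (divides (2 * k) (solve [ k ]) ∷ divides (2 * k + 1) (solve [ k ]) ∷ [])
      (solve [ k ]) (+- (1 + 6 * k + 6 * k * k) (3 * k) (solve [ k ]))
      (cons 0 (cons (6 * k + 4) nil refl) (solve [ k ]))
  , Bézout⇒IsMinMult-TH (6 * k ∷ 6 * k + 1 ∷ 6 * k + 2 ∷ []) (6 * k + 3) 6 ((2 * k + 1) * (3 * k + 2) * (6 * k + 5))
      (m≤n+m 1 (3 * k))
      (divides (2 * (k * (6 * k + 1))) (solve [ k ]) ∷ divides ((2 * k + 1) * (6 * k + 1)) (solve [ k ])
        ∷ divides (2 * ((2 * k + 1) * (3 * k + 2))) (solve [ k ]) ∷ [])
      (solve [ k ]) (-+ (9 + 20 * k + 12 * k * k) 1 (solve [ k ]))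
      (cons 0 (cons (3 * k + 2) (cons 2 nil refl) refl) (solve [ k ]))

c*-6k+1 : ∀ k →
  c*₂ (6 * k + 1) (6 * k + 1) × c*₃ (6 * k + 1) (3 * k + 1) × c*₄ (6 * k + 1) (2 * k + 1)
c*-6k+1 k =
    Bézout⇒IsMinMult-TH (6 * k + 1 ∷ []) (6 * k + 1 + 1) (6 * ((1 + 2 * k) * (1 + 3 * k))) (2 * (3 * k + 2))
      (m≤n+m 1 (6 * k))
      (divides 1 (solve [ k ]) ∷ [])
      (solve [ k ]) (+- (1 + 2 * k) (2 * k) (solve [ k ]))
      (cons (6 * k + 4) nil (solve [ k ]))
  , Bézout⇒IsMinMult-TH (6 * k + 1 ∷ 6 * k + 1 + 1 ∷ []) (6 * k + 1 + 2) (6 * (1 + 2 * k)) ((3 * k + 2) * (6 * k + 5))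
      (m≤n+m 1 (3 * k))
      (divides (6 * k + 1) (solve [ k ]) ∷ divides (2 * (3 * k + 2)) (solve [ k ]) ∷ [])
      (solve [ k ]) (+- (1 + 7 * k + 6 * k * k) k (solve [ k ]))
      (cons (3 * k + 2) (cons 2 nil refl) (solve [ k ]))
  , Bézout⇒IsMinMult-TH (6 * k + 1 ∷ 6 * k + 1 + 1 ∷ 6 * k + 1 + 2 ∷ []) (6 * k + 1 + 3) 6
      (2 * ((k + 1) * (3 * k + 2) * (6 * k + 5)))
      (m≤n+m 1 (2 * k))
      (divides ((3 * k + 1) * (6 * k + 1)) (solve [ k ]) ∷ divides (2 * ((3 * k + 1) * (3 * k + 2))) (solve [ k ])
        ∷ divides ((3 * k + 2) * (6 * k + 5)) (solve [ k ]) ∷ [])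
      (solve [ k ]) (-+ (19 + 36 * k + 18 * k * k) 1 (solve [ k ]))
      (cons 0 (cons 0 (cons (2 * k + 2) nil refl) refl) (solve [ k ]))

c*-6k+2 : ∀ k →
  c*₂ (6 * k + 2) (6 * k + 2) × c*₃ (6 * k + 2) (2 * k + 1) × c*₄ (6 * k + 2) (3 * k + 2)
c*-6k+2 k =
    Bézout⇒IsMinMult-TH (6 * k + 2 ∷ []) (6 * k + 2 + 1) (6 * ((1 + 2 * k) * (2 + 3 * k))) (6 * k + 5)
      (≤-trans (s≤s z≤n) (m≤n+m 2 (6 * k)))
      (divides 1 (solve [ k ]) ∷ [])
      (solve [ k ]) (-+ (2 + 2 * k) (1 + 2 * k) (solve [ k ]))
      (cons (6 * k + 5) nil (solve [ k ]))
  , Bézout⇒IsMinMult-TH (6 * k + 2 ∷ 6 * k + 2 + 1 ∷ []) (6 * k + 2 + 2) (6 * (2 + 3 * k)) (2 * ((k + 1) * (6 * k + 5)))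
      (m≤n+m 1 (2 * k))
      (divides (2 * (3 * k + 1)) (solve [ k ]) ∷ divides (6 * k + 5) (solve [ k ]) ∷ [])
      (solve [ k ]) (+- (1 + 8 * k + 6 * k * k) k (solve [ k ]))
      (cons 0 (cons (2 * k + 2) nil refl) (solve [ k ]))
  , Bézout⇒IsMinMult-TH (6 * k + 2 ∷ 6 * k + 2 + 1 ∷ 6 * k + 2 + 2 ∷ []) (6 * k + 2 + 3) 6
      ((k + 1) * (6 * k + 5) * (6 * k + 7))
      (≤-trans (s≤s z≤n) (m≤n+m 2 (3 * k)))
      (divides (2 * ((2 * k + 1) * (3 * k + 1))) (solve [ k ]) ∷ divides ((2 * k + 1) * (6 * k + 5)) (solve [ k ])
        ∷ divides (2 * ((k + 1) * (6 * k + 5))) (solve [ k ]) ∷ [])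
      (solve [ k ]) (-+ (17 + 28 * k + 12 * k * k) 1 (solve [ k ]))
      (cons 0 (cons (k + 1) (cons (2 * k + 3) nil refl) refl) (solve [ k ]))

c*-6k+3 : ∀ k →
  c*₂ (6 * k + 3) (2 * k + 1) × c*₃ (6 * k + 3) (3 * k + 2) × c*₄ (6 * k + 3) (6 * k + 3 + 2)
c*-6k+3 k =
    Bézout⇒IsMinMult-TH (6 * k + 3 ∷ []) (6 * k + 3 + 1) (6 * ((2 + 3 * k) * (5 + 6 * k))) (2 * (k + 1))
      (m≤n+m 1 (2 * k))
      (divides 1 (solve [ k ]) ∷ [])
      (solve [ k ]) (-+ 1 1 (solve [ k ]))
      (cons (2 * k + 2) nil (solve [ k ]))
  , Bézout⇒IsMinMult-TH (6 * k + 3 ∷ 6 * k + 3 + 1 ∷ []) (6 * k + 3 + 2) (6 * (5 + 6 * k)) ((k + 1) * (6 * k + 7))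
      (≤-trans (s≤s z≤n) (m≤n+m 2 (3 * k)))
      (divides (2 * k + 1) (solve [ k ]) ∷ divides (2 * (k + 1)) (solve [ k ]) ∷ [])
      (solve [ k ]) (-+ (3 + 2 * k) 1 (solve [ k ]))
      (cons (k + 1) (cons (2 * k + 3) nil refl) (solve [ k ]))
  , Bézout⇒IsMinMult-TH (6 * k + 3 ∷ 6 * k + 3 + 1 ∷ 6 * k + 3 + 2 ∷ []) (6 * k + 3 + 3) 6
      (2 * ((k + 1) * (3 * k + 4) * (6 * k + 7)))
      (≤-trans (s≤s z≤n) (m≤n+m 2 (6 * k + 3)))
      (divides ((2 * k + 1) * (3 * k + 2)) (solve [ k ]) ∷ divides (2 * ((k + 1) * (3 * k + 2))) (solve [ k ])
        ∷ divides ((k + 1) * (6 * k + 7)) (solve [ k ]) ∷ [])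
      (solve [ k ]) (-+ (11 + 16 * k + 6 * k * k) 1 (solve [ k ]))
      (cons 0 (cons 0 (cons (6 * k + 8) nil refl) refl) (solve [ k ]))

m≡n*o⇒m/o≡n : ∀ m n o .{{_ : NonZero o}} → m ≡ n * o → m / o ≡ n
m≡n*o⇒m/o≡n _ n o refl = m*n/n≡m n o

4≤6k⇒1≤k : ∀ {k} → 4 ≤ 6 * k → 1 ≤ k
4≤6k⇒1≤k {suc k} _ = s≤s z≤n

lemma30 : (n k : ℕ) → 4 ≤ n →
    (n ≡ 6 * k → c*₂ n (n / 3) × c*₃ n (n + 1) × c*₄ n ((n + 2) / 2))
    × (n ≡ 6 * k + 1 → c*₂ n n × c*₃ n ((n + 1) / 2) × c*₄ n ((n + 2) / 3))
    × (n ≡ 6 * k + 2 → c*₂ n n × c*₃ n ((n + 1) / 3) × c*₄ n ((n + 2) / 2))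
    × (n ≡ 6 * k + 3 → c*₂ n (n / 3) × c*₃ n ((n + 1) / 2) × c*₄ n (n + 2))
lemma30 n k 4≤n = at-6k , at-6k+1 , at-6k+2 , at-6k+3
  where
  at-6k : n ≡ 6 * k → c*₂ n (n / 3) × c*₃ n (n + 1) × c*₄ n ((n + 2) / 2)
  at-6k refl rewrite m≡n*o⇒m/o≡n (6 * k) (2 * k) 3 (solve [ k ])
                   | m≡n*o⇒m/o≡n (6 * k + 2) (3 * k + 1) 2 (solve [ k ]) = c*-6k k (4≤6k⇒1≤k 4≤n)

  at-6k+1 : n ≡ 6 * k + 1 → c*₂ n n × c*₃ n ((n + 1) / 2) × c*₄ n ((n + 2) / 3)
  at-6k+1 refl rewrite m≡n*o⇒m/o≡n (6 * k + 1 + 1) (3 * k + 1) 2 (solve [ k ])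
                     | m≡n*o⇒m/o≡n (6 * k + 1 + 2) (2 * k + 1) 3 (solve [ k ]) = c*-6k+1 k

  at-6k+2 : n ≡ 6 * k + 2 → c*₂ n n × c*₃ n ((n + 1) / 3) × c*₄ n ((n + 2) / 2)
  at-6k+2 refl rewrite m≡n*o⇒m/o≡n (6 * k + 2 + 1) (2 * k + 1) 3 (solve [ k ])
                     | m≡n*o⇒m/o≡n (6 * k + 2 + 2) (3 * k + 2) 2 (solve [ k ]) = c*-6k+2 k

  at-6k+3 : n ≡ 6 * k + 3 → c*₂ n (n / 3) × c*₃ n ((n + 1) / 2) × c*₄ n (n + 2)
  at-6k+3 refl rewrite m≡n*o⇒m/o≡n (6 * k + 3) (2 * k + 1) 3 (solve [ k ])
                     | m≡n*o⇒m/o≡n (6 * k + 3 + 1) (3 * k + 2) 2 (solve [ k ]) = c*-6k+3 k
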